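{- Let $(G,k)$ be an instance of PHCAVD with a nice modulator $T$. Suppose more than $k+1$ connected components of $G-T$ are interval graphs having no neighbor in $T$, and let $G'$ be obtained from $G$ by deleting all vertices of all but $k+1$ of these components. Then $(G,k)$ is a yes-instance if and only if $(G',k)$ is a yes-instance.
   Context: A proper Helly circular-arc graph (PHCA graph) is the intersection graph of a finite family of arcs on a circle such that no arc properly contains another and every subfamily of pairwise intersecting arcs has a common point. PHCAVD: given $(G,k)$, decide whether some $S\subseteq V(G)$, $|S|\le k$, has $G-S$ PHCA. Obstructions are induced subgraphs isomorphic to: the claw $K_{1,3}$, net, tent, $W_4$, $W_5$, $\overline{C_6}$, or $C_\ell^*$ ($\ell\ge4$; induced $C_\ell$ plus an isolated vertex); a graph is PHCA iff it has none; small = fewer than 12 vertices, large otherwise. A $t$-solution is $S$ with $|S|\le t$ and $G-S$ PHCA; a family is $t$-necessary if every $t$-solution meets every member. A nice modulator for $(G,k)$ is $T\subseteq V(G)$ with a $(k+2)$-necessary family $\mathcal W\subseteq 2^T$ such that $G-T$ is PHCA, $|T|=O(k^{12})$, every large obstruction containing no member of $\mathcal W$ has at least 6 vertices in $T$, and $T$ contains a set $T_1$ such that every $Y$ with $|Y|\le k$ is a minimal hitting set of all small obstructions of $G$ iff of all small obstructions of $G[T_1]$. -}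

module Defs where

open import Data.Nat using (ℕ; zero; suc; _+_; _*_; _^_; _≤_; _<_; _∸_; _≡ᵇ_; _<ᵇ_)
open import Data.Bool using (Bool; true; false; _∧_; _∨_; not)
open import Data.Fin using (Fin; toℕ)
open import Data.Fin.Subset using (Subset; _∈_; _∉_; _⊆_; _∩_; ∣_∣)
open import Data.List using (List; []; _∷_)
open import Data.Product using (Σ; _×_; _,_; ∃; ∃-syntax)
open import Data.Empty using (⊥)
open import Relation.Nullary using (¬_)
open import Relation.Binary.PropositionalEquality using (_≡_; _≢_)
open import Function using (_⇔_)
open import Function.Definitions using (Injective)

record Graph : Set where
  field
    n      : ℕ
    adj    : Fin n → Fin n → Bool
    sym    : ∀ u v → adj u v ≡ adj v u
    irrefl : ∀ u → adj u u ≡ false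
open Graph public

edgesAdj : List (ℕ × ℕ) → ℕ → ℕ → Bool
edgesAdj [] a b = false
edgesAdj ((x , y) ∷ es) a b =
  ((a ≡ᵇ x) ∧ (b ≡ᵇ y)) ∨ ((a ≡ᵇ y) ∧ (b ≡ᵇ x)) ∨ edgesAdj es a b

cycleAdj : ℕ → ℕ → ℕ → Bool
cycleAdj ℓ a b = (a <ᵇ ℓ) ∧ (b <ᵇ ℓ) ∧
  ((b ≡ᵇ suc a) ∨ (a ≡ᵇ suc b) ∨
   ((a ≡ᵇ 0) ∧ (b ≡ᵇ (ℓ ∸ 1))) ∨ ((b ≡ᵇ 0) ∧ (a ≡ᵇ (ℓ ∸ 1))))

-- Names of the obstructions, indexed by their number of vertices.
-- cstar m is C_ℓ^* with ℓ = 4 + m (so ℓ ≥ 4): the cycle on 0 … ℓ-1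
-- plus the isolated vertex ℓ.
data Obs : ℕ → Set where
  claw  : Obs 4
  net   : Obs 6
  tent  : Obs 6
  W4    : Obs 5
  W5    : Obs 6
  C6bar : Obs 6
  cstar : (m : ℕ) → Obs (5 + m)

obsAdjℕ : ∀ {m} → Obs m → ℕ → ℕ → Bool
obsAdjℕ claw  = edgesAdj ((0 , 1) ∷ (0 , 2) ∷ (0 , 3) ∷ [])
obsAdjℕ net   = edgesAdj ((0 , 1) ∷ (1 , 2) ∷ (0 , 2) ∷ (0 , 3) ∷ (1 , 4) ∷ (2 , 5) ∷ [])
obsAdjℕ tent  = edgesAdj ((0 , 1) ∷ (1 , 2) ∷ (0 , 2) ∷ (3 , 0) ∷ (3 , 1)
                          ∷ (4 , 1) ∷ (4 , 2) ∷ (5 , 2) ∷ (5 , 0) ∷ [])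
obsAdjℕ W4    a b = cycleAdj 4 a b ∨ edgesAdj ((4 , 0) ∷ (4 , 1) ∷ (4 , 2) ∷ (4 , 3) ∷ []) a b
obsAdjℕ W5    a b = cycleAdj 5 a b ∨
                    edgesAdj ((5 , 0) ∷ (5 , 1) ∷ (5 , 2) ∷ (5 , 3) ∷ (5 , 4) ∷ []) a b
obsAdjℕ C6bar a b = not (a ≡ᵇ b) ∧ not (cycleAdj 6 a b)
obsAdjℕ (cstar m) = cycleAdj (4 + m)

obsAdj : ∀ {m} → Obs m → Fin m → Fin m → Bool
obsAdj o i j = obsAdjℕ o (toℕ i) (toℕ j)

IsObsCopy : (G : Graph) → ∀ {m} → Obs m → (Fin m → Fin (n G)) → Subset (n G) → Set
IsObsCopy G o f X =
  Injective _≡_ _≡_ f ×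
  (∀ v → v ∈ X ⇔ (∃[ i ] f i ≡ v)) ×
  (∀ i j → adj G (f i) (f j) ≡ obsAdj o i j)

IsObstruction : (G : Graph) → Subset (n G) → Set
IsObstruction G X = Σ ℕ λ m → Σ (Obs m) λ o → Σ (Fin m → Fin (n G)) λ f → IsObsCopy G o f X

Small Large : ∀ {n} → Subset n → Set
Small X = ∣ X ∣ < 12
Large X = 12 ≤ ∣ X ∣

-- Proper Helly circular-arc graphs, via the obstruction characterisation:
-- G[U] (U a vertex predicate) is PHCA iff it contains no obstruction.
PHCAOn : (G : Graph) → (Fin (n G) → Set) → Set
PHCAOn G U = ∀ X → IsObstruction G X → ¬ (∀ v → v ∈ X → U v)

PHCAMinus : (G : Graph) → Subset (n G) → Set
PHCAMinus G S = PHCAOn G (λ v → v ∉ S)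

IsSolution : (G : Graph) → ℕ → Subset (n G) → Set
IsSolution G t S = ∣ S ∣ ≤ t × PHCAMinus G S

Meets : ∀ {n} → Subset n → Subset n → Set
Meets A B = ∃[ v ] (v ∈ A × v ∈ B)

Necessary : (G : Graph) → ℕ → (Subset (n G) → Set) → Set
Necessary G t 𝒲 = ∀ S → IsSolution G t S → ∀ W → 𝒲 W → Meets S W

Hits : ∀ {n} → (Subset n → Set) → Subset n → Set
Hits ℱ Y = ∀ X → ℱ X → Meets Y X

MinHitting : ∀ {n} → (Subset n → Set) → Subset n → Set
MinHitting ℱ Y = Hits ℱ Y × (∀ Y' → Y' ⊆ Y → Hits ℱ Y' → Y ⊆ Y')

SmallObsOf : (G : Graph) → Subset (n G) → Set
SmallObsOf G X = IsObstruction G X × Small X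

SmallObsWithin : (G : Graph) → Subset (n G) → Subset (n G) → Set
SmallObsWithin G T₁ X = IsObstruction G X × Small X × X ⊆ T₁

-- Nice modulator.  The bound |T| = O(k^12) is made explicit by a
-- constant c : |T| ≤ c · (k+1)^12.

record NiceModulator (c : ℕ) (G : Graph) (k : ℕ) (T : Subset (n G)) : Set₁ where
  field
    𝒲          : Subset (n G) → Set
    𝒲⊆2^T      : ∀ W → 𝒲 W → W ⊆ T
    𝒲-necessary : Necessary G (k + 2) 𝒲
    G-T-PHCA   : PHCAMinus G T
    size       : ∣ T ∣ ≤ c * (suc k ^ 12)
    large-obs  : ∀ X → IsObstruction G X → Large X →
                 (∀ W → 𝒲 W → ¬ (W ⊆ X)) → 6 ≤ ∣ X ∩ T ∣
    T₁         : Subset (n G)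
    T₁⊆T       : T₁ ⊆ T
    T₁-small   : ∀ Y → ∣ Y ∣ ≤ k →
                 (MinHitting (SmallObsOf G) Y ⇔ MinHitting (SmallObsWithin G T₁) Y)

YesOn : (G : Graph) → (Fin (n G) → Set) → ℕ → Set
YesOn G U k = ∃[ S ] ((∀ v → v ∈ S → U v) × ∣ S ∣ ≤ k × PHCAOn G (λ v → U v × v ∉ S))

Yes : Graph → ℕ → Set
Yes G k = YesOn G (λ _ → Data.Unit.⊤) k
  where import Data.Unit

data Reach (G : Graph) (T : Subset (n G)) (u : Fin (n G)) : Fin (n G) → Set where
  here : u ∉ T → Reach G T u u
  step : ∀ {v w} → Reach G T u v → adj G v w ≡ true → w ∉ T → Reach G T u w

-- G[P] is an interval graph (intersection graph of closed intervals on
-- the line; for finite graphs integer endpoints suffice)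
IntervalOn : (G : Graph) → (Fin (n G) → Set) → Set
IntervalOn G P = Σ (Fin (n G) → ℕ) λ l → Σ (Fin (n G) → ℕ) λ r →
  (∀ u → P u → l u ≤ r u) ×
  (∀ u w → P u → P w → u ≢ w → ((adj G u w ≡ true) ⇔ (l u ≤ r w × l w ≤ r u)))

GoodVertex : (G : Graph) → Subset (n G) → Fin (n G) → Set
GoodVertex G T v = v ∉ T × IntervalOn G (Reach G T v) ×
  (∀ u w → Reach G T v u → w ∈ T → adj G u w ≡ false)

-- vertices of the graph G' : delete every good component that does not
-- contain one of the kept representatives
KeptVertex : (G : Graph) → Subset (n G) → ∀ {r} → (Fin r → Fin (n G)) → Fin (n G) → Set
KeptVertex G T keep v = ¬ (GoodVertex G T v × (∀ i → ¬ Reach G T (keep i) v))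

{-# OPTIONS --safe #-}
-- Call a vertex detached if its component C of G − T has no neighbour in T,
-- so that C is also a component of G.  The core of an obstruction (all of it
-- but the isolated vertex, or apex, of C_ℓ^*) is connected, so if a core
-- vertex is detached the whole core lies in C ⊆ G − T; moving the apex to a
-- vertex of another component of G − T then gives an obstruction inside
-- G − T, which the modulator excludes.  So only the apex of a C_ℓ^* can be
-- detached, and it may be moved to any other detached component.
module Submission where

open import Defs renaming (sym to adj-sym)
open import Data.Bool using (true; false)
open import Data.Bool.Properties using (T-≡; ∧-zeroʳ; ¬-not; not-¬) renaming (_≟_ to _≟𝔹_)
open import Data.Empty using (⊥; ⊥-elim)
open import Data.Fin using (Fin; toℕ; fromℕ<)
  renaming (zero to 0F; suc to sucF)
open import Data.Fin.Properties
  using (toℕ-fromℕ<; fromℕ<-toℕ; toℕ-injective; toℕ<n; any?; all?; ¬∀⟶∃¬; 0≢1+n)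
  renaming (_≟_ to _≟ᶠ_; suc-injective to sucF-injective)
open import Data.Fin.Subset using (Subset; _∈_; _∉_; _⊆_; ∣_∣; _-_)
open import Data.Fin.Subset.Properties
  using (_∈?_; anySubset?; p⊆q⇒∣p∣≤∣q∣; x∈p∧x≢y⇒x∈p-y; x∈p⇒∣p-x∣<∣p∣)
open import Data.Nat using (ℕ; zero; suc; _+_; _<ᵇ_; _≡ᵇ_; _<_; _≤_; z≤n; s≤s)
open import Data.Nat.Properties
  using (<⇒<ᵇ; <-trans; n<1+n; m<n⇒m<1+n; ≤∧≢⇒<; ≤-pred; ≤-trans; <⇒≱)
  renaming (_≟_ to _≟ℕ_)
open import Data.Product using (_×_; _,_; proj₁; proj₂; ∃; ∃-syntax)
open import Data.Unit using (⊤; tt)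
open import Data.Vec using (tabulate)
open import Data.Vec.Properties using (lookup∘tabulate; lookup⇒[]=; []=⇒lookup)
open import Function using (_∘_; _⇔_; mk⇔; Equivalence)
open import Function.Definitions using (Injective)
import Function.Properties.Equivalence as ⇔
open import Level using (0ℓ)
open import Relation.Binary.Construct.Closure.ReflexiveTransitive using (Star; ε; _◅_; _◅◅_; return)
open import Relation.Binary.Construct.Closure.ReflexiveTransitive.Properties using (module StarReasoning)
open import Relation.Binary.PropositionalEquality using (_≡_; _≢_; refl; sym; trans; subst; subst₂)
open import Relation.Nullary using (¬_; yes; no)
open import Relation.Nullary.Decidable
  using (_×-dec_; _→-dec_; ¬?; isYes; toWitness; fromWitness; ¬¬-excluded-middle)
open import Relation.Unary using (Pred; Decidable)

subsetOf : ∀ {N} {P : Pred (Fin N) 0ℓ} → Decidable P → Subset N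
subsetOf P? = tabulate (isYes ∘ P?)

∈-subsetOf⁺ : ∀ {N} {P : Pred (Fin N) 0ℓ} (P? : Decidable P) {v} → P v → v ∈ subsetOf P?
∈-subsetOf⁺ P? {v} p =
  lookup⇒[]= v _ (trans (lookup∘tabulate (isYes ∘ P?) v) (Equivalence.to T-≡ (fromWitness {a? = P? v} p)))

∈-subsetOf⁻ : ∀ {N} {P : Pred (Fin N) 0ℓ} (P? : Decidable P) {v} → v ∈ subsetOf P? → P v
∈-subsetOf⁻ P? {v} v∈ =
  toWitness {a? = P? v} (Equivalence.from T-≡ (trans (sym (lookup∘tabulate (isYes ∘ P?) v)) ([]=⇒lookup v∈)))

¬¬-decidable : ∀ {N} (P : Pred (Fin N) 0ℓ) → ¬ ¬ Decidable P
¬¬-decidable {zero}  P ¬P? = ¬P? (λ ())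
¬¬-decidable {suc N} P ¬P? = ¬¬-excluded-middle λ P₀? →
  ¬¬-decidable (P ∘ sucF) λ P₊? → ¬P? λ { 0F → P₀? ; (sucF v) → P₊? v }

image : ∀ {m N} → (Fin m → Fin N) → Subset N
image f = subsetOf (λ v → any? (λ i → f i ≟ᶠ v))

∈-image⇔ : ∀ {m N} {f : Fin m → Fin N} {v} → v ∈ image f ⇔ ∃ λ i → f i ≡ v
∈-image⇔ {f = f} = mk⇔ (∈-subsetOf⁻ (λ v → any? (λ i → f i ≟ᶠ v)))
                       (∈-subsetOf⁺ (λ v → any? (λ i → f i ≟ᶠ v)))

injective⇒≤∣p∣ : ∀ {r N} {f : Fin r → Fin N} → Injective _≡_ _≡_ f →
                 (p : Subset N) → (∀ i → f i ∈ p) → r ≤ ∣ p ∣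
injective⇒≤∣p∣ {zero}          f-inj p f∈p = z≤n
injective⇒≤∣p∣ {suc r} {f = f} f-inj p f∈p =
  ≤-trans (s≤s (injective⇒≤∣p∣ (sucF-injective ∘ f-inj) (p - f 0F) f₊∈p-f₀))
          (x∈p⇒∣p-x∣<∣p∣ (f∈p 0F))
  where
  f₊∈p-f₀ : ∀ i → f (sucF i) ∈ p - f 0F
  f₊∈p-f₀ i = x∈p∧x≢y⇒x∈p-y (f∈p (sucF i)) (λ e → 0≢1+n (f-inj (sym e)))

injective⇒∃∉ : ∀ {r N} {f : Fin r → Fin N} → Injective _≡_ _≡_ f →
                    (p : Subset N) → ∣ p ∣ < r → ∃ λ i → f i ∉ p
injective⇒∃∉ {r} {f = f} f-inj p ∣p∣<r =
  ¬∀⟶∃¬ r _ (λ i → f i ∈? p) (λ all∈p → <⇒≱ ∣p∣<r (injective⇒≤∣p∣ f-inj p all∈p))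

<ᵇ-irrefl : ∀ ℓ → (ℓ <ᵇ ℓ) ≡ false
<ᵇ-irrefl zero    = refl
<ᵇ-irrefl (suc ℓ) = <ᵇ-irrefl ℓ

≡ᵇ-refl : ∀ a → (a ≡ᵇ a) ≡ true
≡ᵇ-refl zero    = refl
≡ᵇ-refl (suc a) = ≡ᵇ-refl a

cycleAdj-outˡ : ∀ ℓ b → cycleAdj ℓ ℓ b ≡ false
cycleAdj-outˡ ℓ b rewrite <ᵇ-irrefl ℓ = refl

cycleAdj-outʳ : ∀ ℓ a → cycleAdj ℓ a ℓ ≡ false
cycleAdj-outʳ ℓ a rewrite <ᵇ-irrefl ℓ = ∧-zeroʳ (a <ᵇ ℓ)

cycleAdj-suc : ∀ ℓ a → suc a < ℓ → cycleAdj ℓ a (suc a) ≡ true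
cycleAdj-suc ℓ a a+1<ℓ
  rewrite Equivalence.to T-≡ (<⇒<ᵇ (<-trans (n<1+n a) a+1<ℓ))
        | Equivalence.to T-≡ (<⇒<ᵇ a+1<ℓ)
        | ≡ᵇ-refl a
        = refl

Core : ∀ {m} → Obs m → Pred (Fin m) 0ℓ
Core (cstar m) j = toℕ j ≢ 4 + m
Core claw      _ = ⊤
Core net       _ = ⊤
Core tent      _ = ⊤
Core W4        _ = ⊤
Core W5        _ = ⊤
Core C6bar     _ = ⊤

data CoreView : ∀ {m} → Obs m → Set where
  connected      : ∀ {m} {o : Obs m} → (∀ j → Core o j) → CoreView o
  cycle+isolated : ∀ m → CoreView (cstar m)

coreView : ∀ {m} (o : Obs m) → CoreView o
coreView claw      = connected (λ _ → tt)
coreView net       = connected (λ _ → tt)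
coreView tent      = connected (λ _ → tt)
coreView W4        = connected (λ _ → tt)
coreView W5        = connected (λ _ → tt)
coreView C6bar     = connected (λ _ → tt)
coreView (cstar m) = cycle+isolated m

ObsEdge : ∀ {m} → Obs m → Fin m → Fin m → Set
ObsEdge o a b = obsAdj o a b ≡ true

apex-row : ∀ m a b → toℕ a ≡ 4 + m → obsAdj (cstar m) a b ≡ false
apex-row m a b a≡ℓ =
  subst (λ t → cycleAdj (4 + m) t (toℕ b) ≡ false) (sym a≡ℓ) (cycleAdj-outˡ (4 + m) (toℕ b))

apex-col : ∀ m a b → toℕ b ≡ 4 + m → obsAdj (cstar m) a b ≡ false
apex-col m a b b≡ℓ =
  subst (λ t → cycleAdj (4 + m) (toℕ a) t ≡ false) (sym b≡ℓ) (cycleAdj-outʳ (4 + m) (toℕ a))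

cycle-walk : ∀ m q (q<ℓ : q < 4 + m) → Star (ObsEdge (cstar m)) 0F (fromℕ< (m<n⇒m<1+n q<ℓ))
cycle-walk m zero    _     = ε
cycle-walk m (suc q) q+1<ℓ = cycle-walk m q q<ℓ ◅◅ return edge
  where
  q<ℓ : q < 4 + m
  q<ℓ = <-trans (n<1+n q) q+1<ℓ
  edge : ObsEdge (cstar m) (fromℕ< (m<n⇒m<1+n q<ℓ)) (fromℕ< (m<n⇒m<1+n q+1<ℓ))
  edge = subst₂ (λ a b → cycleAdj (4 + m) a b ≡ true)
                (sym (toℕ-fromℕ< (m<n⇒m<1+n q<ℓ))) (sym (toℕ-fromℕ< (m<n⇒m<1+n q+1<ℓ)))
                (cycleAdj-suc (4 + m) q q+1<ℓ)

pattern 1F = sucF 0F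
pattern 2F = sucF 1F
pattern 3F = sucF 2F
pattern 4F = sucF 3F
pattern 5F = sucF 4F

core-linked : ∀ {m} (o : Obs m) → ∃[ h ] (∀ j → Core o j → Star (ObsEdge o) h j)
core-linked claw = 0F , λ where
    0F _ → ε
    1F _ → return refl
    2F _ → return refl
    3F _ → return refl
core-linked net = 0F , λ where
    0F _ → ε
    1F _ → return refl
    2F _ → return refl
    3F _ → return refl
    4F _ → begin 0F ⟶⟨ refl ⟩ 1F ⟶⟨ refl ⟩ 4F ∎
    5F _ → begin 0F ⟶⟨ refl ⟩ 2F ⟶⟨ refl ⟩ 5F ∎
  where open StarReasoning (ObsEdge net)
core-linked tent = 0F , λ where
    0F _ → ε
    1F _ → return refl
    2F _ → return refl
    3F _ → return refl
    4F _ → begin 0F ⟶⟨ refl ⟩ 1F ⟶⟨ refl ⟩ 4F ∎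
    5F _ → return refl
  where open StarReasoning (ObsEdge tent)
core-linked W4 = 0F , λ where
    0F _ → ε
    1F _ → return refl
    2F _ → begin 0F ⟶⟨ refl ⟩ 1F ⟶⟨ refl ⟩ 2F ∎
    3F _ → return refl
    4F _ → return refl
  where open StarReasoning (ObsEdge W4)
core-linked W5 = 0F , λ where
    0F _ → ε
    1F _ → return refl
    2F _ → begin 0F ⟶⟨ refl ⟩ 1F ⟶⟨ refl ⟩ 2F ∎
    3F _ → begin 0F ⟶⟨ refl ⟩ 4F ⟶⟨ refl ⟩ 3F ∎
    4F _ → return refl
    5F _ → return refl
  where open StarReasoning (ObsEdge W5)
core-linked C6bar = 0F , λ where
    0F _ → ε
    1F _ → begin 0F ⟶⟨ refl ⟩ 3F ⟶⟨ refl ⟩ 1F ∎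
    2F _ → return refl
    3F _ → return refl
    4F _ → return refl
    5F _ → begin 0F ⟶⟨ refl ⟩ 2F ⟶⟨ refl ⟩ 5F ∎
  where open StarReasoning (ObsEdge C6bar)
core-linked (cstar m) = 0F , λ j j-core →
  subst (Star _ 0F) (fromℕ<-toℕ j _) (cycle-walk m (toℕ j) (≤∧≢⇒< (≤-pred (toℕ<n j)) j-core))

copy⇒obstruction : ∀ {G : Graph} {m} (o : Obs m) {f : Fin m → Fin (n G)} →
                   Injective _≡_ _≡_ f → (∀ i j → adj G (f i) (f j) ≡ obsAdj o i j) →
                   IsObstruction G (image f)
copy⇒obstruction o f-inj f-adj = _ , o , _ , f-inj , (λ _ → ∈-image⇔) , f-adj

module ApexSwap {G : Graph} {m} {f : Fin (5 + m) → Fin (n G)}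
                (f-inj : Injective _≡_ _≡_ f)
                (f-adj : ∀ i j → adj G (f i) (f j) ≡ obsAdj (cstar m) i j)
                {z} (z-new : ∀ j → Core (cstar m) j → f j ≢ z)
                (z-nonadj : ∀ j → Core (cstar m) j → adj G (f j) z ≡ false) where

  swapped : Fin (5 + m) → Fin (n G)
  swapped j with toℕ j ≟ℕ 4 + m
  ... | yes _ = z
  ... | no  _ = f j

  swapped-injective : Injective _≡_ _≡_ swapped
  swapped-injective {a} {b} e with toℕ a ≟ℕ 4 + m | toℕ b ≟ℕ 4 + m
  ... | yes a≡ℓ | yes b≡ℓ = toℕ-injective (trans a≡ℓ (sym b≡ℓ))
  ... | yes _   | no  b≢ℓ = ⊥-elim (z-new b b≢ℓ (sym e))
  ... | no  a≢ℓ | yes _   = ⊥-elim (z-new a a≢ℓ e)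
  ... | no  _   | no  _   = f-inj e

  swapped-adj : ∀ a b → adj G (swapped a) (swapped b) ≡ obsAdj (cstar m) a b
  swapped-adj a b with toℕ a ≟ℕ 4 + m | toℕ b ≟ℕ 4 + m
  ... | yes a≡ℓ | yes _   = trans (irrefl G z) (sym (apex-row m a b a≡ℓ))
  ... | yes a≡ℓ | no  b≢ℓ = trans (adj-sym G z (f b)) (trans (z-nonadj b b≢ℓ) (sym (apex-row m a b a≡ℓ)))
  ... | no  a≢ℓ | yes b≡ℓ = trans (z-nonadj a a≢ℓ) (sym (apex-col m a b b≡ℓ))
  ... | no  _   | no  _   = f-adj a b

  swap-apex : (U : Pred (Fin (n G)) 0ℓ) → PHCAOn G U → U z → (∀ j → Core (cstar m) j → U (f j)) → ⊥
  swap-apex U U-PHCA z∈U core⊆U =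
    U-PHCA (image swapped) (copy⇒obstruction {G = G} (cstar m) swapped-injective swapped-adj) image⊆U
    where
    swapped∈U : ∀ j → U (swapped j)
    swapped∈U j with toℕ j ≟ℕ 4 + m
    ... | yes _   = z∈U
    ... | no  j≢ℓ = core⊆U j j≢ℓ

    image⊆U : ∀ v → v ∈ image swapped → U v
    image⊆U v v∈ = let (j , e) = Equivalence.to ∈-image⇔ v∈ in subst U e (swapped∈U j)

module Components (G : Graph) (T : Subset (n G)) where

  Vertex : Set
  Vertex = Fin (n G)

  copy-∈ : ∀ {m} (o : Obs m) {f X} → IsObsCopy G o f X → ∀ j → f j ∈ X
  copy-∈ o (_ , X≡im-f , _) j = Equivalence.from (X≡im-f _) (j , refl)

  ∈-copy : ∀ {m} (o : Obs m) {f X} → IsObsCopy G o f X → ∀ {v} → v ∈ X → ∃ λ j → f j ≡ v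
  ∈-copy o (_ , X≡im-f , _) v∈X = Equivalence.to (X≡im-f _) v∈X

  reach⇒∉ : ∀ {u v} → Reach G T u v → v ∉ T
  reach⇒∉ (here v∉T)     = v∉T
  reach⇒∉ (step _ _ v∉T) = v∉T

  reach-trans : ∀ {u v w} → Reach G T u v → Reach G T v w → Reach G T u w
  reach-trans u↝v (here _)           = u↝v
  reach-trans u↝v (step v↝w e w∉T) = step (reach-trans u↝v v↝w) e w∉T

  reach-sym : ∀ {u v} → Reach G T u v → Reach G T v u
  reach-sym (here u∉T)                       = here u∉T
  reach-sym (step {v} {w} u↝v e w∉T) =
    reach-trans (step (here w∉T) (trans (adj-sym G w v) e) (reach⇒∉ u↝v)) (reach-sym u↝v)

  Detached : Pred Vertex 0ℓ
  Detached x = x ∉ T × (∀ u w → Reach G T x u → w ∈ T → adj G u w ≡ false)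

  good⇒detached : ∀ {x} → GoodVertex G T x → Detached x
  good⇒detached (x∉T , _ , no-T-nbr) = x∉T , no-T-nbr

  reach-adj : ∀ {x u w} → Detached x → Reach G T x u → adj G u w ≡ true → Reach G T x w
  reach-adj {u = u} {w} (_ , no-T-nbr) x↝u e = step x↝u e λ w∈T → not-¬ e (no-T-nbr u w x↝u w∈T)

  reach-detached : ∀ {x u} → Detached x → Reach G T x u → Detached u
  reach-detached (_ , no-T-nbr) x↝u =
    reach⇒∉ x↝u , λ u' w u↝u' → no-T-nbr u' w (reach-trans x↝u u↝u')

  module _ {x} (x-det : Detached x) {m} {o : Obs m} {f : Fin m → Vertex}
           (f-adj : ∀ i j → adj G (f i) (f j) ≡ obsAdj o i j) where

    edge-reach : ∀ {a b} → ObsEdge o a b → Reach G T x (f a) ⇔ Reach G T x (f b)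
    edge-reach {a} {b} e = mk⇔ (λ x↝fa → reach-adj x-det x↝fa fa~fb)
                              (λ x↝fb → reach-adj x-det x↝fb (trans (adj-sym G (f b) (f a)) fa~fb))
      where
      fa~fb : adj G (f a) (f b) ≡ true
      fa~fb = trans (f-adj a b) e

    walk-reach : ∀ {a b} → Star (ObsEdge o) a b → Reach G T x (f a) ⇔ Reach G T x (f b)
    walk-reach ε       = ⇔.refl
    walk-reach (e ◅ w) = ⇔.trans (edge-reach e) (walk-reach w)

  core-in-component : ∀ {m} {o : Obs m} {f : Fin m → Vertex} →
                      (∀ i j → adj G (f i) (f j) ≡ obsAdj o i j) →
                      ∀ {i} → Core o i → Detached (f i) → ∀ {j} → Core o j → Reach G T (f i) (f j)
  core-in-component {o = o} f-adj {i} i-core fi-det {j} j-core with core-linked o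
  ... | _ , walk = Equivalence.to (walk-reach fi-det {o = o} f-adj (walk j j-core))
                     (Equivalence.from (walk-reach fi-det {o = o} f-adj (walk i i-core)) (here (proj₁ fi-det)))

  -- Reachability is not evidently decidable, but lying in a closed set is (by
  -- search over all subsets), and it agrees with being detached up to double
  -- negation; this is what lets us decide which solution vertices to discard.
  Closed : Pred (Subset (n G)) 0ℓ
  Closed C = ∀ u → u ∈ C → u ∉ T × (∀ w → adj G u w ≡ true → w ∈ C)

  closed? : Decidable Closed
  closed? C = all? λ u →
    (u ∈? C) →-dec (¬? (u ∈? T) ×-dec all? λ w → (adj G u w ≟𝔹 true) →-dec (w ∈? C))

  InClosed : Pred Vertex 0ℓ
  InClosed x = ∃[ C ] (x ∈ C × Closed C)

  inClosed? : Decidable InClosed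
  inClosed? x = anySubset? λ C → (x ∈? C) ×-dec closed? C

  closed-reach : ∀ {C x u} → Closed C → x ∈ C → Reach G T x u → u ∈ C
  closed-reach C-closed x∈C (here _)     = x∈C
  closed-reach C-closed x∈C (step x↝v e _) = proj₂ (C-closed _ (closed-reach C-closed x∈C x↝v)) _ e

  inClosed⇒detached : ∀ {x} → InClosed x → Detached x
  inClosed⇒detached {x} (C , x∈C , C-closed) = proj₁ (C-closed x x∈C) , no-T-nbr
    where
    no-T-nbr : ∀ u w → Reach G T x u → w ∈ T → adj G u w ≡ false
    no-T-nbr u w x↝u w∈T = ¬-not λ e →
      proj₁ (C-closed w (proj₂ (C-closed u (closed-reach C-closed x∈C x↝u)) w e)) w∈T

  detached⇒¬¬inClosed : ∀ {x} → Detached x → ¬ ¬ InClosed x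
  detached⇒¬¬inClosed {x} x-det ¬inClosed = ¬¬-decidable (Reach G T x) λ reach? →
    let component = subsetOf reach? in
    ¬inClosed (component , ∈-subsetOf⁺ reach? (here (proj₁ x-det)) , λ u u∈ →
      let x↝u = ∈-subsetOf⁻ reach? u∈ in
      reach⇒∉ x↝u , λ w e → ∈-subsetOf⁺ reach? (reach-adj x-det x↝u e))

module DetachedObstructions (G : Graph) (T : Subset (n G)) (G-T-PHCA : PHCAMinus G T)
                            {u₀ u₁} (u₀∉T : u₀ ∉ T) (u₁∉T : u₁ ∉ T)
                            (u₀↛u₁ : ¬ Reach G T u₀ u₁) where
  open Components G T

  unreachable-exists : ∀ x → ¬ ¬ (∃ λ y → y ∉ T × ¬ Reach G T x y)
  unreachable-exists x none =
    none (u₀ , u₀∉T , λ x↝u₀ →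
    none (u₁ , u₁∉T , λ x↝u₁ → u₀↛u₁ (reach-trans (reach-sym x↝u₀) x↝u₁)))

  no-edge-across : ∀ {x u y} → Detached x → Reach G T x u → ¬ Reach G T x y → adj G u y ≡ false
  no-edge-across x-det x↝u x↛y = ¬-not λ e → x↛y (reach-adj x-det x↝u e)

  core-not-detached : ∀ {m} {o : Obs m} {f X} → IsObsCopy G o f X → ∀ {i} → Core o i → ¬ Detached (f i)
  core-not-detached {o = o} {f} {X} (f-inj , X≡im-f , f-adj) {i} i-core fi-det with coreView o
  ... | connected all-core =
    G-T-PHCA X (_ , o , f , f-inj , X≡im-f , f-adj) λ v v∈X →
      let (j , fj≡v) = ∈-copy o (f-inj , X≡im-f , f-adj) v∈X
      in subst (_∉ T) fj≡v (reach⇒∉ (core-in-component f-adj i-core fi-det (all-core j)))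
  ... | cycle+isolated m = unreachable-exists (f i) λ (y , y∉T , fi↛y) →
    let fi↝ : ∀ {j} → Core (cstar m) j → Reach G T (f i) (f j)
        fi↝ = core-in-component f-adj i-core fi-det
    in ApexSwap.swap-apex {G = G} f-inj f-adj
         (λ j j-core fj≡y → fi↛y (subst (Reach G T (f i)) fj≡y (fi↝ j-core)))
         (λ j j-core → no-edge-across fi-det (fi↝ j-core) fi↛y)
         (_∉ T) G-T-PHCA y∉T (λ j j-core → reach⇒∉ (fi↝ j-core))

  detached-apex-swap : ∀ {m f X} → IsObsCopy G (cstar m) f X → ∀ {z} → Detached z →
                       (U : Pred Vertex 0ℓ) → PHCAOn G U → U z →
                       (∀ j → Core (cstar m) j → U (f j)) → ⊥
  detached-apex-swap {f = f} cp@(f-inj , _ , f-adj) {z} z-det =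
    ApexSwap.swap-apex {G = G} f-inj f-adj
      (λ j j-core fj≡z → core-not-detached cp j-core (subst Detached (sym fj≡z) z-det))
      (λ j j-core → ¬-not λ e → core-not-detached cp j-core (reach-detached z-det (z↝fj j e)))
    where
    z↝fj : ∀ j → adj G (f j) z ≡ true → Reach G T z (f j)
    z↝fj j e = reach-adj z-det (here (proj₁ z-det)) (trans (adj-sym G z (f j)) e)

  detached-not-in-obstruction : ∀ {m} {o : Obs m} {f X} → IsObsCopy G o f X →
                                (U : Pred Vertex 0ℓ) → PHCAOn G U → (∀ j → Core o j → U (f j)) →
                                (∃ λ z → Detached z × U z) → ∀ {v} → v ∈ X → ¬ Detached v
  detached-not-in-obstruction {o = o} cp U U-PHCA core⊆U (z , z-det , z∈U) v∈X v-det
    with ∈-copy o cp v∈X | coreView o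
  ... | i , refl | connected all-core = core-not-detached cp (all-core i) v-det
  ... | i , refl | cycle+isolated m with toℕ i ≟ℕ 4 + m
  ...   | no  i-core = core-not-detached cp i-core v-det
  ...   | yes _      = detached-apex-swap cp z-det U U-PHCA z∈U core⊆U

module KeptComponents (G : Graph) (T : Subset (n G)) (G-T-PHCA : PHCAMinus G T)
                      {u₀ u₁} (u₀∉T : u₀ ∉ T) (u₁∉T : u₁ ∉ T)
                      (u₀↛u₁ : ¬ Reach G T u₀ u₁)
                      {k} (keep : Fin (suc k) → Fin (n G))
                      (keep-good : ∀ i → GoodVertex G T (keep i))
                      (keep-apart : ∀ i j → i ≢ j → ¬ Reach G T (keep i) (keep j)) where
  open Components G T
  open DetachedObstructions G T G-T-PHCA u₀∉T u₁∉T u₀↛u₁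

  Kept : Pred Vertex 0ℓ
  Kept = KeptVertex G T keep

  keep-injective : Injective _≡_ _≡_ keep
  keep-injective {i} {j} keep-i≡keep-j with i ≟ᶠ j
  ... | yes i≡j = i≡j
  ... | no  i≢j = ⊥-elim (keep-apart i j i≢j
                            (subst (Reach G T (keep i)) keep-i≡keep-j (here (proj₁ (keep-good i)))))

  kept-survivor : (S : Subset (n G)) → ∣ S ∣ ≤ k → ∃ λ z → Detached z × Kept z × z ∉ S
  kept-survivor S ∣S∣≤k with injective⇒∃∉ keep-injective S (s≤s ∣S∣≤k)
  ... | j , keep-j∉S = keep j , good⇒detached (keep-good j) , keep-j-kept , keep-j∉S
    where
    keep-j-kept : Kept (keep j)
    keep-j-kept (_ , unreached) = unreached j (here (proj₁ (keep-good j)))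

  solution-extends : YesOn G Kept k → Yes G k
  solution-extends (S , _ , ∣S∣≤k , G'-S-PHCA) = S , (λ _ _ → tt) , ∣S∣≤k , G-S-PHCA
    where
    G-S-PHCA : PHCAOn G (λ v → ⊤ × v ∉ S)
    G-S-PHCA X X-obs@(_ , o , f , cp) X⊆V∖S = G'-S-PHCA X X-obs λ v v∈X → X⊆Kept v∈X , X∉S v∈X
      where
      X∉S : ∀ {v} → v ∈ X → v ∉ S
      X∉S v∈X = proj₂ (X⊆V∖S _ v∈X)

      core-kept : ∀ j → Core o j → Kept (f j) × f j ∉ S
      core-kept j j-core = (λ (fj-good , _) → core-not-detached cp j-core (good⇒detached fj-good))
                         , X∉S (copy-∈ o cp j)

      X⊆Kept : ∀ {v} → v ∈ X → Kept v
      X⊆Kept v∈X (v-good , _) =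
        detached-not-in-obstruction cp _ G'-S-PHCA core-kept (kept-survivor S ∣S∣≤k)
                                    v∈X (good⇒detached v-good)

  solution-restricts : Yes G k → YesOn G Kept k
  solution-restricts (S , _ , ∣S∣≤k , G-S-PHCA) =
    S' , S'⊆Kept , ≤-trans (p⊆q⇒∣p∣≤∣q∣ S'⊆S) ∣S∣≤k , G'-S'-PHCA
    where
    undetached? : Decidable (λ v → v ∈ S × ¬ InClosed v)
    undetached? v = (v ∈? S) ×-dec ¬? (inClosed? v)

    S' : Subset (n G)
    S' = subsetOf undetached?

    S'⊆S : S' ⊆ S
    S'⊆S v∈S' = proj₁ (∈-subsetOf⁻ undetached? v∈S')

    S'⊆Kept : ∀ v → v ∈ S' → Kept v
    S'⊆Kept v v∈S' (v-good , _) =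
      detached⇒¬¬inClosed (good⇒detached v-good) (proj₂ (∈-subsetOf⁻ undetached? v∈S'))

    G'-S'-PHCA : PHCAOn G (λ v → Kept v × v ∉ S')
    G'-S'-PHCA X X-obs@(_ , o , f , cp) X⊆G'-S' = G-S-PHCA X X-obs λ v v∈X → tt , X∉S v∈X
      where
      X∩S-detached : ∀ {v} → v ∈ X → v ∈ S → Detached v
      X∩S-detached {v} v∈X v∈S with inClosed? v
      ... | yes v-inClosed = inClosed⇒detached v-inClosed
      ... | no  ¬inClosed  =
        ⊥-elim (proj₂ (X⊆G'-S' v v∈X) (∈-subsetOf⁺ undetached? (v∈S , ¬inClosed)))

      core∉S : ∀ j → Core o j → ⊤ × f j ∉ S
      core∉S j j-core = tt , λ fj∈S → core-not-detached cp j-core (X∩S-detached (copy-∈ o cp j) fj∈S)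

      X∉S : ∀ {v} → v ∈ X → v ∉ S
      X∉S v∈X v∈S =
        let (z , z-det , _ , z∉S) = kept-survivor S ∣S∣≤k in
        detached-not-in-obstruction cp _ G-S-PHCA core∉S (z , z-det , tt , z∉S)
                                    v∈X (X∩S-detached v∈X v∈S)

lemma16 : (c : ℕ) (G : Graph) (k : ℕ) (T : Subset (n G)) → NiceModulator c G k T →
          (many : Fin (suc (suc k)) → Fin (n G)) →
          (∀ i → GoodVertex G T (many i)) →
          (∀ i j → i ≢ j → ¬ Reach G T (many i) (many j)) →
          (keep : Fin (suc k) → Fin (n G)) →
          (∀ i → GoodVertex G T (keep i)) →
          (∀ i j → i ≢ j → ¬ Reach G T (keep i) (keep j)) →
          (Yes G k ⇔ YesOn G (KeptVertex G T keep) k)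
lemma16 c G k T modulator many many-good many-apart keep keep-good keep-apart =
  mk⇔ solution-restricts solution-extends
  where
  open NiceModulator modulator using (G-T-PHCA)
  open KeptComponents G T G-T-PHCA (proj₁ (many-good 0F)) (proj₁ (many-good 1F)) (many-apart 0F 1F λ ())
                      keep keep-good keep-apart
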